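{- Let $L$ be a large even integer with $\sqrt L$ an integer, let $V=\{v_1,v_2,v_3,v_4\}$ with all degree bounds $1$, and write a unit-weight job as (source, destination, size, release time). Let $\mathcal S_1$ consist of $\sqrt L$ jobs $(v_1,v_2,1,1)$, $\mathcal S_2$ of $\sqrt L$ jobs $(v_3,v_2,1,1)$, $\mathcal S_3=\{(v_3,v_4,1,\sqrt L+i): i\in[L]\}$, $\mathcal S_4=\{(v_1,v_4,1,\sqrt L+i): i\in[L]\}$, and let the instance be $\mathcal T_1=\mathcal S_1\cup\mathcal S_2\cup\mathcal S_3$ with probability $1/2$ and $\mathcal T_2=\mathcal S_1\cup\mathcal S_2\cup\mathcal S_4$ with probability $1/2$, so the number of jobs is $n=L+2\sqrt L$. Then for any deterministic online algorithm $\mathcal A$ (speed $1$), the expected total flow time $\sum_i (c(i)-r_i)$ of $\mathcal A$ on this random instance is $\Omega(n^{3/2})$.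
   Context: Time is slotted. In each slot a schedule processes a set of released uncompleted unit-size jobs forming a matching on $V$ (each node is an endpoint of at most one processed job); a processed job is completed at that slot, $c(i)$ denoting the completion time of job $i$. An online algorithm learns of a job only at its release time. -}

module Defs where

open import Data.Nat using (ℕ; zero; suc; _+_; _*_; _∸_; _≤_; _≤ᵇ_)
open import Data.Fin using (Fin; toℕ)
import Data.Fin
open import Data.List using (List; []; _∷_; _++_; map; replicate; upTo; filter; length; lookup; allFin)
open import Data.Nat.ListAction using (sum)
open import Data.List.Membership.Propositional using (_∈_)
open import Data.Product using (_×_)
open import Function.Bundles using (_⇔_)
open import Relation.Binary.PropositionalEquality using (_≡_; _≢_)
open import Relation.Nullary.Decidable using (Dec)
open import Data.Nat.Properties using (_≤?_)

-- Nodes V = {v₁,v₂,v₃,v₄} are Fin 4: v₁ = 0, v₂ = 1, v₃ = 2, v₄ = 3.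
-- A job with unit size and unit weight: (source, destination, release time).
record Job : Set where
  constructor job
  field
    src : Fin 4
    dst : Fin 4
    rel : ℕ
open Job public

v₁ v₂ v₃ v₄ : Fin 4
v₁ = Data.Fin.zero
v₂ = Data.Fin.suc Data.Fin.zero
v₃ = Data.Fin.suc (Data.Fin.suc Data.Fin.zero)
v₄ = Data.Fin.suc (Data.Fin.suc (Data.Fin.suc Data.Fin.zero))

-- An instance is a list of jobs (a job's identity is its position).
Instance : Set
Instance = List Job

-- k = √L, so L = k * k.
-- S₁: √L jobs (v₁,v₂,1,1);  S₂: √L jobs (v₃,v₂,1,1)
S₁ S₂ : ℕ → Instance
S₁ k = replicate k (job v₁ v₂ 1)
S₂ k = replicate k (job v₃ v₂ 1)

S₃ S₄ : ℕ → Instance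
S₃ k = map (λ i → job v₃ v₄ (k + suc i)) (upTo (k * k))
S₄ k = map (λ i → job v₁ v₄ (k + suc i)) (upTo (k * k))

T₁ T₂ : ℕ → Instance
T₁ k = S₁ k ++ S₂ k ++ S₃ k
T₂ k = S₁ k ++ S₂ k ++ S₄ k

njobs : ℕ → ℕ
njobs k = k * k + 2 * k

-- Jobs sharing no endpoint (degree bounds all equal to 1).
Disjoint : Job → Job → Set
Disjoint a b = (src a ≢ src b) × (src a ≢ dst b) × (dst a ≢ src b) × (dst a ≢ dst b)

-- A schedule for instance I is given by completion times c (slots 1,2,…):
-- each job is processed in exactly one slot c i ≥ r_i (after release),
-- and the jobs processed in a common slot form a matching on V.
ValidSchedule : (I : Instance) → (Fin (length I) → ℕ) → Set
ValidSchedule I c =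
  ((i : Fin (length I)) → rel (lookup I i) ≤ c i) ×
  ((i j : Fin (length I)) → i ≢ j → c i ≡ c j → Disjoint (lookup I i) (lookup I j))

flow : (I : Instance) → (Fin (length I) → ℕ) → ℕ
flow I c = sum (map (λ i → c i ∸ rel (lookup I i)) (allFin (length I)))

revealed : Instance → ℕ → Instance
revealed I t = filter (λ j → rel j ≤? t) I

-- A deterministic online algorithm: at slot t, knowing only the jobs revealed so far
-- (its own past decisions are a deterministic function of this information),
-- it chooses which revealed jobs (by position) to process in slot t.
OnlineAlg : Set
OnlineAlg = (t : ℕ) → (R : Instance) → List (Fin (length R))

-- The algorithm A, run on instance I (listed in nondecreasing release order),
-- produces the schedule with completion times c: job i is processed in slot t
-- exactly when A chooses it at slot t.
Runs : OnlineAlg → (I : Instance) → (Fin (length I) → ℕ) → Set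
Runs A I c = (i : Fin (length I)) (t : ℕ) →
  (c i ≡ t) ⇔ (toℕ i ∈ map toℕ (A t (revealed I t)))

module Submission where

-- Write N = k² (= L). Both instances start with the 2k unit jobs of S₁ ∪ S₂, all
-- using node v₂ and released at slot 1, and differ only in a stream of N jobs
-- released at slots k+1, …, k+N: from v₃ (in T₁) or from v₁ (in T₂).
--  * Capacity: jobs sharing a node occupy distinct slots, so at most k of the 2k
--    initial jobs finish by slot k; at least k are late.
--  * Indistinguishability: up to slot k the algorithm sees the same jobs in T₁ and
--    T₂, so it finishes the same S₂-jobs late in both.
--  * Congestion: m late jobs sharing a node with a stream of N arrivals occupy, together
--    with it, m + N distinct slots after k; comparing with the releases k+1, …, k+N
--    gives total flow time at least m·N (late S₁-jobs in T₂, late S₂-jobs in T₁).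
-- Summing, flow(T₁) + flow(T₂) ≥ k·N = k³, and n³ = (k² + 2k)³ ≤ (6k³)².

open import Defs
open import Data.Nat using (ℕ; zero; suc; _+_; _*_; _∸_; _^_; _≤_; _<_; z≤n; s≤s)
open import Data.Nat.Divisibility using (_∣_)
open import Data.Nat.ListAction using (sum)
open import Data.Nat.ListAction.Properties using (sum-++; sum-↭)
open import Data.Nat.Properties
open import Algebra.Properties.CommutativeSemigroup +-commutativeSemigroup using (interchange)
open import Data.Nat.Tactic.RingSolver using (solve-∀)
open import Data.Fin using (Fin; toℕ) renaming (zero to fzero; suc to fsuc)
import Data.Fin.Properties as Fin
open import Data.List using (List; []; _∷_; _++_; length; map; filter; replicate; upTo; applyUpTo; lookup; tabulate)
open import Data.List.Properties using (length-map; map-∘; map-++; length-++; map-tabulate; map-upTo; length-upTo; length-replicate; filter-++; filter-none; ++-identityʳ; ++-assoc)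
open import Data.List.Membership.Propositional using (_∈_)
open import Data.List.Relation.Binary.Permutation.Propositional using (_↭_; ↭-sym; ↭⇒↭ₛ)
open import Data.List.Relation.Binary.Permutation.Propositional.Properties using (All-resp-↭; ↭-length)
import Data.List.Relation.Binary.Permutation.Setoid.Properties as PermutationSetoid
open import Data.List.Relation.Binary.Pointwise using (Pointwise; []; _∷_)
open import Data.List.Relation.Binary.Sublist.Propositional using (_⊆_; []; _∷_; _∷ʳ_; ⊆-refl)
open import Data.List.Relation.Binary.Sublist.Propositional.Properties using (All-resp-⊆; filter-⊆; ++⁺; ++⁺ˡ; ++⁺ʳ)
open import Data.List.Relation.Unary.All as All using (All; []; _∷_)
import Data.List.Relation.Unary.All.Properties as All
open import Data.List.Relation.Unary.AllPairs using (AllPairs; []; _∷_)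
import Data.List.Relation.Unary.AllPairs.Properties as AllPairs
open import Data.List.Relation.Unary.Linked as Linked using (Linked; []; [-]; _∷_)
open import Data.List.Relation.Unary.Linked.Properties using (AllPairs⇒Linked)
open import Data.List.Relation.Unary.Unique.Propositional using (Unique)
open import Data.List.Sort ≤-decTotalOrder using (sort; sort-↭; sort-↗)
open import Data.Product using (_×_; _,_; proj₁; proj₂; ∃-syntax)
open import Data.Sum using (_⊎_; inj₁; inj₂)
open import Function using (_∘_)
open import Function.Bundles using (_⇔_; mk⇔; Equivalence)
open import Relation.Binary.PropositionalEquality
open import Relation.Nullary using (¬_; yes; no; contradiction)
open import Relation.Nullary.Decidable using (¬?)
open import Relation.Unary using (Decidable)

consecutiveSum : ℕ → ℕ → ℕ
consecutiveSum k zero    = 0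
consecutiveSum k (suc n) = suc k + consecutiveSum (suc k) n

consecutiveSum-mono : ∀ {j j′} n → j ≤ j′ → consecutiveSum j n ≤ consecutiveSum j′ n
consecutiveSum-mono zero    j≤j′ = z≤n
consecutiveSum-mono (suc n) j≤j′ = +-mono-≤ (s≤s j≤j′) (consecutiveSum-mono n (s≤s j≤j′))

consecutiveSum-+ : ∀ k a b → consecutiveSum k (a + b) ≡ consecutiveSum k a + consecutiveSum (k + a) b
consecutiveSum-+ k zero    b = cong (λ j → consecutiveSum j b) (sym (+-identityʳ k))
consecutiveSum-+ k (suc a) b = begin
  suc k + consecutiveSum (suc k) (a + b)
    ≡⟨ cong (suc k +_) (consecutiveSum-+ (suc k) a b) ⟩
  suc k + (consecutiveSum (suc k) a + consecutiveSum (suc k + a) b)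
    ≡⟨ sym (+-assoc (suc k) _ _) ⟩
  suc k + consecutiveSum (suc k) a + consecutiveSum (suc k + a) b
    ≡⟨ cong (λ j → suc k + consecutiveSum (suc k) a + consecutiveSum j b) (sym (+-suc k a)) ⟩
  suc k + consecutiveSum (suc k) a + consecutiveSum (k + suc a) b ∎
  where open ≡-Reasoning

-- Every term of the run exceeds k.
consecutiveSum-≥ : ∀ k n → n * suc k ≤ consecutiveSum k n
consecutiveSum-≥ k zero    = z≤n
consecutiveSum-≥ k (suc n) =
  +-monoʳ-≤ (suc k) (≤-trans (*-monoʳ-≤ n (n≤1+n (suc k))) (consecutiveSum-≥ (suc k) n))

sum-applyUpTo : ∀ k n (f : ℕ → ℕ) → (∀ i → f i ≡ k + suc i) → sum (applyUpTo f n) ≡ consecutiveSum k n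
sum-applyUpTo k zero    f f≗ = refl
sum-applyUpTo k (suc n) f f≗ =
  cong₂ _+_ (trans (f≗ 0) (+-comm k 1))
            (sum-applyUpTo (suc k) n (λ i → f (suc i)) (λ i → trans (f≗ (suc i)) (+-suc k (suc i))))

-- A strictly increasing list starting above k dominates k+1, k+2, …, termwise.
ascending-sum : ∀ k xs → Linked _<_ (k ∷ xs) → consecutiveSum k (length xs) ≤ sum xs
ascending-sum k []       _           = z≤n
ascending-sum k (x ∷ xs) (k<x ∷ inc) =
  +-mono-≤ k<x (≤-trans (consecutiveSum-mono (length xs) k<x) (ascending-sum x xs inc))

ascending-length : ∀ k B xs → Linked _<_ (k ∷ xs) → All (_≤ B) xs → k ≤ B → length xs + k ≤ B
ascending-length k B []       _           []          k≤B = k≤B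
ascending-length k B (x ∷ xs) (k<x ∷ inc) (x≤B ∷ ≤B) _  = begin
  suc (length xs + k) ≡⟨ sym (+-suc (length xs) k) ⟩
  length xs + suc k   ≤⟨ +-monoʳ-≤ (length xs) k<x ⟩
  length xs + x       ≤⟨ ascending-length x B xs inc ≤B x≤B ⟩
  B                   ∎
  where open ≤-Reasoning

sortDistinct : ∀ xs → Unique xs → ∃[ ys ] ys ↭ xs × Linked _<_ ys
sortDistinct xs distinct = sort xs , sort-↭ xs ,
  Linked.zipWith (λ (x≤y , x≢y) → ≤∧≢⇒< x≤y x≢y)
    (sort-↗ xs , AllPairs⇒Linked (PermutationSetoid.Unique-resp-↭ (setoid ℕ) (↭⇒↭ₛ (↭-sym (sort-↭ xs))) distinct))

prepend-below : ∀ {k ys} → All (k <_) ys → Linked _<_ ys → Linked _<_ (k ∷ ys)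
prepend-below []          []  = [-]
prepend-below (k<y ∷ _) inc = k<y ∷ inc

distinct-sum : ∀ k xs → Unique xs → All (k <_) xs → consecutiveSum k (length xs) ≤ sum xs
distinct-sum k xs distinct above with sortDistinct xs distinct
... | ys , ys↭xs , inc =
  subst₂ (λ n s → consecutiveSum k n ≤ s) (↭-length ys↭xs) (sum-↭ ys↭xs)
    (ascending-sum k ys (prepend-below (All-resp-↭ (↭-sym ys↭xs) above) inc))

distinct-count : ∀ B xs → Unique xs → All (0 <_) xs → All (_≤ B) xs → length xs ≤ B
distinct-count B xs distinct positive bounded with sortDistinct xs distinct
... | ys , ys↭xs , inc =
  subst (_≤ B) (trans (+-identityʳ _) (↭-length ys↭xs))
    (ascending-length 0 B ys (prepend-below (All-resp-↭ (↭-sym ys↭xs) positive) inc)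
                              (All-resp-↭ (↭-sym ys↭xs) bounded) z≤n)

Placed : Set
Placed = Job × ℕ

jobOf : Placed → Job
jobOf = proj₁

slot : Placed → ℕ
slot = proj₂

wait : Placed → ℕ
wait a = slot a ∸ rel (jobOf a)

flowSum : List Placed → ℕ
flowSum xs = sum (map wait xs)

placements : (I : Instance) → (Fin (length I) → ℕ) → List Placed
placements []      c = []
placements (j ∷ I) c = (j , c fzero) ∷ placements I (c ∘ fsuc)

placements-jobs : ∀ I c → map jobOf (placements I c) ≡ I
placements-jobs []      c = refl
placements-jobs (j ∷ I) c = cong (j ∷_) (placements-jobs I (c ∘ fsuc))

flow-placements : ∀ I c → flow I c ≡ flowSum (placements I c)
flow-placements I c =
  trans (cong sum (map-tabulate (λ i → i) (λ i → c i ∸ rel (lookup I i)))) (tabulated I c)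
  where
  tabulated : ∀ I c → sum (tabulate (λ i → c i ∸ rel (lookup I i))) ≡ flowSum (placements I c)
  tabulated []      c = refl
  tabulated (j ∷ I) c = cong (c fzero ∸ rel j +_) (tabulated I (c ∘ fsuc))

inLeft : ∀ (P Q : Instance) → Fin (length P) → Fin (length (P ++ Q))
inLeft (j ∷ P) Q fzero    = fzero
inLeft (j ∷ P) Q (fsuc i) = fsuc (inLeft P Q i)

inRight : ∀ (P Q : Instance) → Fin (length Q) → Fin (length (P ++ Q))
inRight []      Q i = i
inRight (j ∷ P) Q i = fsuc (inRight P Q i)

toℕ-inLeft : ∀ (P Q : Instance) i → toℕ (inLeft P Q i) ≡ toℕ i
toℕ-inLeft (j ∷ P) Q fzero    = refl
toℕ-inLeft (j ∷ P) Q (fsuc i) = cong suc (toℕ-inLeft P Q i)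

toℕ-inRight : ∀ (P Q : Instance) i → toℕ (inRight P Q i) ≡ length P + toℕ i
toℕ-inRight []      Q i = refl
toℕ-inRight (j ∷ P) Q i = cong suc (toℕ-inRight P Q i)

placements-++ : ∀ (P Q : Instance) c →
  placements (P ++ Q) c ≡ placements P (c ∘ inLeft P Q) ++ placements Q (c ∘ inRight P Q)
placements-++ []      Q c = refl
placements-++ (j ∷ P) Q c = cong ((j , c fzero) ∷_) (placements-++ P Q (c ∘ fsuc))

All-placements : ∀ {P : Job → ℕ → Set} I c → (∀ i → P (lookup I i) (c i)) →
  All (λ a → P (jobOf a) (slot a)) (placements I c)
All-placements []      c h = []
All-placements (j ∷ I) c h = h fzero ∷ All-placements I (c ∘ fsuc) (h ∘ fsuc)

Released : Placed → Set
Released a = rel (jobOf a) ≤ slot a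

Compatible : Placed → Placed → Set
Compatible a b = slot a ≡ slot b → Disjoint (jobOf a) (jobOf b)

ConflictFree : List Placed → Set
ConflictFree = AllPairs Compatible

valid-placements : ∀ I c → ValidSchedule I c → All Released (placements I c) × ConflictFree (placements I c)
valid-placements I c (released , compatible) = All-placements I c released , conflictFree I c compatible
  where
  conflictFree : ∀ I c → (∀ i j → i ≢ j → c i ≡ c j → Disjoint (lookup I i) (lookup I j)) →
    ConflictFree (placements I c)
  conflictFree []      c h = []
  conflictFree (j ∷ I) c h =
    All-placements I (c ∘ fsuc) (λ i → h fzero (fsuc i) λ ())
    ∷ conflictFree I (c ∘ fsuc) (λ i i′ i≢i′ → h (fsuc i) (fsuc i′) (i≢i′ ∘ Fin.suc-injective))

placements-All : ∀ {P : Job → Set} I c → All P I → All (P ∘ jobOf) (placements I c)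
placements-All I c h = All.map⁻ (subst (All _) (sym (placements-jobs I c)) h)

placements-length : ∀ I c → length (placements I c) ≡ length I
placements-length I c = trans (sym (length-map jobOf (placements I c))) (cong length (placements-jobs I c))

placements-releases : ∀ I c → sum (map (rel ∘ jobOf) (placements I c)) ≡ sum (map rel I)
placements-releases I c = cong sum (trans (map-∘ (placements I c)) (cong (map rel) (placements-jobs I c)))

AllPairs-⊆ : ∀ {A : Set} {R : A → A → Set} {xs ys} → xs ⊆ ys → AllPairs R ys → AllPairs R xs
AllPairs-⊆ []          []         = []
AllPairs-⊆ (y ∷ʳ xs⊆ys) (_ ∷ Rys) = AllPairs-⊆ xs⊆ys Rys
AllPairs-⊆ (refl ∷ xs⊆ys) (Ry ∷ Rys) = All-resp-⊆ xs⊆ys Ry ∷ AllPairs-⊆ xs⊆ys Rys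

sum-⊆ : ∀ {A : Set} (f : A → ℕ) {xs ys} → xs ⊆ ys → sum (map f xs) ≤ sum (map f ys)
sum-⊆ f []              = z≤n
sum-⊆ f (y ∷ʳ xs⊆ys)    = ≤-trans (sum-⊆ f xs⊆ys) (m≤n+m _ (f y))
sum-⊆ f (refl ∷ xs⊆ys)  = +-monoʳ-≤ _ (sum-⊆ f xs⊆ys)

sum-bounded : ∀ {A : Set} (f : A → ℕ) b {xs} → All (λ x → f x ≤ b) xs → sum (map f xs) ≤ length xs * b
sum-bounded f b []        = z≤n
sum-bounded f b (fx≤b ∷ h) = +-mono-≤ fx≤b (sum-bounded f b h)

Touches : Fin 4 → Job → Set
Touches v j = src j ≡ v ⊎ dst j ≡ v

touching-not-disjoint : ∀ {v} a b → Touches v a → Touches v b → ¬ Disjoint a b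
touching-not-disjoint _ _ (inj₁ sa) (inj₁ sb) (ss , _ , _ , _) = ss (trans sa (sym sb))
touching-not-disjoint _ _ (inj₁ sa) (inj₂ db) (_ , sd , _ , _) = sd (trans sa (sym db))
touching-not-disjoint _ _ (inj₂ da) (inj₁ sb) (_ , _ , ds , _) = ds (trans da (sym sb))
touching-not-disjoint _ _ (inj₂ da) (inj₂ db) (_ , _ , _ , dd) = dd (trans da (sym db))

distinctSlots : ∀ {v} {xs : List Placed} → All (Touches v ∘ jobOf) xs → ConflictFree xs → Unique (map slot xs)
distinctSlots []        []        = []
distinctSlots {xs = a ∷ _} (ta ∷ ts) (ca ∷ cf) = All.map⁺ (apart a ta ts ca) ∷ distinctSlots ts cf
  where
  apart : ∀ {v} a {xs : List Placed} → Touches v (jobOf a) → All (Touches v ∘ jobOf) xs →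
    All (Compatible a) xs → All (λ b → slot a ≢ slot b) xs
  apart a {[]}     ta []        []        = []
  apart a {b ∷ xs} ta (tb ∷ ts) (cb ∷ cs) =
    (λ same → touching-not-disjoint (jobOf a) (jobOf b) ta tb (cb same)) ∷ apart a ta ts cs

flow-balance : ∀ xs → All Released xs →
  flowSum xs + sum (map (rel ∘ jobOf) xs) ≡ sum (map slot xs)
flow-balance []       []         = refl
flow-balance (a ∷ xs) (ra ∷ rxs) =
  trans (interchange (wait a) (flowSum xs) (rel (jobOf a)) _)
        (cong₂ _+_ (m∸n+n≡m ra) (flow-balance xs rxs))

lateJobs : ℕ → List Placed → List Placed
lateJobs k = filter (λ a → k <? slot a)

lateCount : ℕ → List Placed → ℕ
lateCount k xs = length (lateJobs k xs)

earlyJobs : ℕ → List Placed → List Placed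
earlyJobs k = filter (¬? ∘ λ a → k <? slot a)

length-filter-split : ∀ {A : Set} {P : A → Set} (P? : Decidable P) xs →
  length xs ≡ length (filter P? xs) + length (filter (¬? ∘ P?) xs)
length-filter-split P? []       = refl
length-filter-split P? (x ∷ xs) with P? x
... | yes _ = cong suc (length-filter-split P? xs)
... | no  _ = trans (cong suc (length-filter-split P? xs)) (sym (+-suc _ _))

-- Capacity of a node: jobs sharing an endpoint use distinct slots, so at most k of
-- them can be completed within the slots 1, …, k.
capacity : ∀ {v} k (xs : List Placed) → All (Touches v ∘ jobOf) xs → ConflictFree xs →
  All (λ a → 0 < slot a) xs → length xs ≤ k + lateCount k xs
capacity k xs touch conflictFree positive = begin
  length xs                             ≡⟨ length-filter-split (λ a → k <? slot a) xs ⟩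
  lateCount k xs + length early         ≤⟨ +-monoʳ-≤ (lateCount k xs) earlyBound ⟩
  lateCount k xs + k                    ≡⟨ +-comm (lateCount k xs) k ⟩
  k + lateCount k xs                    ∎
  where
  open ≤-Reasoning
  early = earlyJobs k xs
  earlyBound : length early ≤ k
  earlyBound = subst (_≤ k) (length-map slot early)
    (distinct-count k (map slot early)
      (distinctSlots (All.filter⁺ _ touch) (AllPairs.filter⁺ _ conflictFree))
      (All.map⁺ (All.filter⁺ _ positive))
      (All.map⁺ (All.map ≮⇒≥ (All.all-filter _ xs))))

cancel-common : ∀ C a b F → C + (a + b) ≤ F + (a + C) → b ≤ F
cancel-common C a b F le = +-cancelˡ-≤ (a + C) b F (begin
  (a + C) + b ≡⟨ rearrange C a b ⟩
  C + (a + b) ≤⟨ le ⟩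
  F + (a + C) ≡⟨ +-comm F (a + C) ⟩
  (a + C) + F ∎)
  where
  open ≤-Reasoning
  rearrange : ∀ C a b → (a + C) + b ≡ C + (a + b)
  rearrange = solve-∀

congestion : ∀ {v} k N (G Y : List Placed) →
  All (Touches v ∘ jobOf) (G ++ Y) → ConflictFree (G ++ Y) → All Released (G ++ Y) →
  All (λ a → k < slot a × rel (jobOf a) ≤ suc k) G → All (λ a → k < rel (jobOf a)) Y →
  length Y ≡ N → sum (map (rel ∘ jobOf) Y) ≡ consecutiveSum k N →
  length G * N ≤ flowSum (G ++ Y)
congestion k N G Y touch conflictFree released old stream lengthY releasesY =
  cancel-common (consecutiveSum k N) (m * suc k) (m * N) (flowSum (G ++ Y)) (begin
    consecutiveSum k N + (m * suc k + m * N)       ≡⟨ cong (consecutiveSum k N +_) (split-rate m k N) ⟩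
    consecutiveSum k N + m * suc (k + N)           ≤⟨ +-monoʳ-≤ _ (consecutiveSum-≥ (k + N) m) ⟩
    consecutiveSum k N + consecutiveSum (k + N) m  ≡⟨ sym (consecutiveSum-+ k N m) ⟩
    consecutiveSum k (N + m)                       ≡⟨ cong (consecutiveSum k) slotCount ⟩
    consecutiveSum k (length (map slot (G ++ Y)))  ≤⟨ distinct-sum k _ (distinctSlots touch conflictFree) allLate ⟩
    sum (map slot (G ++ Y))                        ≡⟨ sym (flow-balance (G ++ Y) released) ⟩
    flowSum (G ++ Y) + releases (G ++ Y)           ≤⟨ +-monoʳ-≤ _ releaseBound ⟩
    flowSum (G ++ Y) + (m * suc k + consecutiveSum k N) ∎)
  where
  open ≤-Reasoning
  m = length G
  releases : List Placed → ℕ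
  releases xs = sum (map (rel ∘ jobOf) xs)

  split-rate : ∀ m k N → m * suc k + m * N ≡ m * suc (k + N)
  split-rate = solve-∀

  slotCount : N + m ≡ length (map slot (G ++ Y))
  slotCount = sym (begin-equality
    length (map slot (G ++ Y)) ≡⟨ length-map slot (G ++ Y) ⟩
    length (G ++ Y)            ≡⟨ length-++ G ⟩
    m + length Y               ≡⟨ cong (m +_) lengthY ⟩
    m + N                      ≡⟨ +-comm m N ⟩
    N + m                      ∎)

  allLate : All (k <_) (map slot (G ++ Y))
  allLate = All.map⁺ (All.++⁺ (All.map proj₁ old)
    (All.zipWith (λ (k<r , r≤s) → <-≤-trans k<r r≤s) (stream , All.++⁻ʳ G released)))

  releaseBound : releases (G ++ Y) ≤ m * suc k + consecutiveSum k N
  releaseBound = begin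
    releases (G ++ Y)         ≡⟨ cong sum (map-++ (rel ∘ jobOf) G Y) ⟩
    sum (map (rel ∘ jobOf) G ++ map (rel ∘ jobOf) Y) ≡⟨ sum-++ (map (rel ∘ jobOf) G) _ ⟩
    releases G + releases Y   ≤⟨ +-mono-≤ (sum-bounded (rel ∘ jobOf) (suc k) (All.map proj₂ old))
                                          (≤-reflexive releasesY) ⟩
    m * suc k + consecutiveSum k N ∎

AgreeUpTo : ℕ → ℕ → ℕ → Set
AgreeUpTo k a b = a ≤ k ⊎ b ≤ k → a ≡ b

-- A deterministic online algorithm that has been shown the same jobs during the
-- slots 1, …, k takes the same decisions in those slots: a job it processes at some
-- slot t ≤ k in one instance is processed at t in the other instance as well.
same-early-slot : ∀ k A (I J : Instance) cI cJ → Runs A I cI → Runs A J cJ →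
  (∀ t → t ≤ k → revealed I t ≡ revealed J t) →
  ∀ i j → toℕ i ≡ toℕ j → cI i ≤ k → cJ j ≡ cI i
same-early-slot k A I J cI cJ runI runJ sameHistory i j i≡j early =
  Equivalence.from (runJ j (cI i))
    (subst₂ (λ n R → n ∈ map toℕ (A (cI i) R)) i≡j (sameHistory (cI i) early)
      (Equivalence.to (runI i (cI i)) refl))

online-agree : ∀ k A (I J : Instance) cI cJ → Runs A I cI → Runs A J cJ →
  (∀ t → t ≤ k → revealed I t ≡ revealed J t) →
  ∀ i j → toℕ i ≡ toℕ j → AgreeUpTo k (cI i) (cJ j)
online-agree k A I J cI cJ runI runJ sameHistory i j i≡j (inj₁ early) =
  sym (same-early-slot k A I J cI cJ runI runJ sameHistory i j i≡j early)
online-agree k A I J cI cJ runI runJ sameHistory i j i≡j (inj₂ early) =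
  same-early-slot k A J I cJ cI runJ runI (λ t t≤k → sym (sameHistory t t≤k)) j i (sym i≡j) early

late-iff : ∀ {k a b} → AgreeUpTo k a b → (k < a) ⇔ (k < b)
late-iff agree = mk⇔
  (λ k<a → ≰⇒> λ b≤k → <⇒≱ k<a (subst (_≤ _) (sym (agree (inj₂ b≤k))) b≤k))
  (λ k<b → ≰⇒> λ a≤k → <⇒≱ k<b (subst (_≤ _) (agree (inj₁ a≤k)) a≤k))

filter-length-⇔ : ∀ {A B : Set} {P : A → Set} {Q : B → Set} (P? : Decidable P) (Q? : Decidable Q) {xs ys} →
  Pointwise (λ a b → P a ⇔ Q b) xs ys → length (filter P? xs) ≡ length (filter Q? ys)
filter-length-⇔ P? Q? [] = refl
filter-length-⇔ P? Q? {x ∷ _} {y ∷ _} (x⇔y ∷ rest) with P? x | Q? y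
... | yes _  | yes _  = cong suc (filter-length-⇔ P? Q? rest)
... | no  _  | no  _  = filter-length-⇔ P? Q? rest
... | yes px | no ¬qy = contradiction (Equivalence.to x⇔y px) ¬qy
... | no ¬px | yes qy = contradiction (Equivalence.from x⇔y qy) ¬px

lateCount-agree : ∀ k I (c d : Fin (length I) → ℕ) → (∀ i → AgreeUpTo k (c i) (d i)) →
  lateCount k (placements I c) ≡ lateCount k (placements I d)
lateCount-agree k I c d agree = filter-length-⇔ _ _ (lateness I c d agree)
  where
  lateness : ∀ I (c d : Fin (length I) → ℕ) → (∀ i → AgreeUpTo k (c i) (d i)) →
    Pointwise (λ a b → (k < slot a) ⇔ (k < slot b)) (placements I c) (placements I d)
  lateness []      c d agree = []
  lateness (j ∷ I) c d agree =
    late-iff (agree fzero) ∷ lateness I (c ∘ fsuc) (d ∘ fsuc) (agree ∘ fsuc)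

stream : Fin 4 → Fin 4 → ℕ → ℕ → Instance
stream v w k n = map (λ i → job v w (k + suc i)) (upTo n)

stream-jobs : ∀ v w k n → All (λ j → src j ≡ v × k < rel j) (stream v w k n)
stream-jobs v w k n = All.map⁺ (All.universal (λ i → refl , m<m+n k (s≤s z≤n)) (upTo n))

stream-length : ∀ v w k n → length (stream v w k n) ≡ n
stream-length v w k n = trans (length-map _ (upTo n)) (length-upTo n)

stream-releases : ∀ v w k n → sum (map rel (stream v w k n)) ≡ consecutiveSum k n
stream-releases v w k n =
  trans (cong sum (trans (sym (map-∘ (upTo n))) (map-upTo _ n))) (sum-applyUpTo k n _ (λ i → refl))

revealed-before : ∀ (P R : Instance) t → All (λ j → t < rel j) R → revealed (P ++ R) t ≡ revealed P t
revealed-before P R t later =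
  trans (filter-++ _ P R) (trans (cong (revealed P t ++_) (filter-none _ (All.map <⇒≱ later))) (++-identityʳ _))

revealed-agree : ∀ k t → t ≤ k → revealed (T₁ k) t ≡ revealed (T₂ k) t
revealed-agree k t t≤k = begin
  revealed (S₁ k ++ S₂ k ++ S₃ k) t   ≡⟨ cong (λ I → revealed I t) (sym (++-assoc (S₁ k) (S₂ k) (S₃ k))) ⟩
  revealed ((S₁ k ++ S₂ k) ++ S₃ k) t ≡⟨ revealed-before (S₁ k ++ S₂ k) (S₃ k) t (unrevealed v₃ v₄) ⟩
  revealed (S₁ k ++ S₂ k) t           ≡⟨ sym (revealed-before (S₁ k ++ S₂ k) (S₄ k) t (unrevealed v₁ v₄)) ⟩
  revealed ((S₁ k ++ S₂ k) ++ S₄ k) t ≡⟨ cong (λ I → revealed I t) (++-assoc (S₁ k) (S₂ k) (S₄ k)) ⟩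
  revealed (S₁ k ++ S₂ k ++ S₄ k) t   ∎
  where
  open ≡-Reasoning
  unrevealed : ∀ v w → All (λ j → t < rel j) (stream v w k (k * k))
  unrevealed v w = All.map (λ (_ , k<r) → ≤-<-trans t≤k k<r) (stream-jobs v w k (k * k))

module _ (P Q R : Instance) (c : Fin (length (P ++ Q ++ R)) → ℕ) where

  middleIndex : Fin (length Q) → Fin (length (P ++ Q ++ R))
  middleIndex = inRight P (Q ++ R) ∘ inLeft Q R

  toℕ-middleIndex : ∀ i → toℕ (middleIndex i) ≡ length P + toℕ i
  toℕ-middleIndex i = trans (toℕ-inRight P (Q ++ R) (inLeft Q R i)) (cong (length P +_) (toℕ-inLeft Q R i))

  firstBlock middleBlock lastBlock : List Placed
  firstBlock  = placements P (c ∘ inLeft P (Q ++ R))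
  middleBlock = placements Q (c ∘ middleIndex)
  lastBlock   = placements R (c ∘ inRight P (Q ++ R) ∘ inRight Q R)

  blocks : placements (P ++ Q ++ R) c ≡ firstBlock ++ middleBlock ++ lastBlock
  blocks = trans (placements-++ P (Q ++ R) c) (cong (firstBlock ++_) (placements-++ Q R _))

  valid-blocks : ValidSchedule (P ++ Q ++ R) c →
    All Released (firstBlock ++ middleBlock ++ lastBlock) × ConflictFree (firstBlock ++ middleBlock ++ lastBlock)
  valid-blocks valid = subst (λ W → All Released W × ConflictFree W) blocks (valid-placements (P ++ Q ++ R) c valid)

  flow-blocks : flow (P ++ Q ++ R) c ≡ flowSum (firstBlock ++ middleBlock ++ lastBlock)
  flow-blocks = trans (flow-placements (P ++ Q ++ R) c) (cong flowSum blocks)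

copies : ∀ n (j : Job) c → All (λ a → jobOf a ≡ j) (placements (replicate n j) c)
copies n j c = placements-All (replicate n j) c (All.replicate⁺ n refl)

-- First phase: the 2k jobs of S₁ and S₂ all use v₂, so at least k of them are late
-- (completed after slot k), whatever the rest R of the instance is.
firstPhase : ∀ k R c → ValidSchedule (S₁ k ++ S₂ k ++ R) c →
  k ≤ lateCount k (firstBlock (S₁ k) (S₂ k) R c) + lateCount k (middleBlock (S₁ k) (S₂ k) R c)
firstPhase k R c valid = +-cancelˡ-≤ k k _ (begin
  k + k                              ≡⟨ sym (cong₂ _+_ (size _ _) (size _ _)) ⟩
  length U + length V                ≡⟨ sym (length-++ U) ⟩
  length (U ++ V)                    ≤⟨ capacity k (U ++ V) touch (AllPairs-⊆ sub conflictFree) positive ⟩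
  k + lateCount k (U ++ V)           ≡⟨ cong (k +_) (trans (cong length (filter-++ _ U V)) (length-++ (lateJobs k U))) ⟩
  k + (lateCount k U + lateCount k V) ∎)
  where
  open ≤-Reasoning
  U = firstBlock (S₁ k) (S₂ k) R c
  V = middleBlock (S₁ k) (S₂ k) R c
  released = proj₁ (valid-blocks (S₁ k) (S₂ k) R c valid)
  conflictFree = proj₂ (valid-blocks (S₁ k) (S₂ k) R c valid)
  size : ∀ j d → length (placements (replicate k j) d) ≡ k
  size j d = trans (placements-length (replicate k j) d) (length-replicate k)
  sub : U ++ V ⊆ U ++ V ++ lastBlock (S₁ k) (S₂ k) R c
  sub = ++⁺ (⊆-refl {x = U}) (++⁺ʳ (lastBlock (S₁ k) (S₂ k) R c) ⊆-refl)
  old : All (λ a → dst (jobOf a) ≡ v₂ × rel (jobOf a) ≡ 1) (U ++ V)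
  old = All.++⁺ (All.map (λ e → cong dst e , cong rel e) (copies k _ _))
                (All.map (λ e → cong dst e , cong rel e) (copies k _ _))
  touch : All (Touches v₂ ∘ jobOf) (U ++ V)
  touch = All.map (inj₂ ∘ proj₁) old
  positive : All (λ a → 0 < slot a) (U ++ V)
  positive = All.zipWith (λ ((_ , r≡1) , r≤s) → subst (_≤ _) r≡1 r≤s) (old , All-resp-⊆ sub released)

streamCost : ∀ v w k N (B : List Placed) d (W : List Placed) →
  lateJobs k B ++ placements (stream v w k N) d ⊆ W → All Released W → ConflictFree W →
  All (λ a → src (jobOf a) ≡ v × rel (jobOf a) ≡ 1) B → lateCount k B * N ≤ flowSum W
streamCost v w k N B d W sub released conflictFree old = ≤-trans
  (congestion k N (lateJobs k B) Z touch (AllPairs-⊆ sub conflictFree) (All-resp-⊆ sub released) lateOld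
    (All.map proj₂ arrivals)
    (trans (placements-length (stream v w k N) d) (stream-length v w k N))
    (trans (placements-releases (stream v w k N) d) (stream-releases v w k N)))
  (sum-⊆ wait sub)
  where
  Z = placements (stream v w k N) d
  arrivals : All (λ a → src (jobOf a) ≡ v × k < rel (jobOf a)) Z
  arrivals = placements-All (stream v w k N) d (stream-jobs v w k N)
  touch : All (Touches v ∘ jobOf) (lateJobs k B ++ Z)
  touch = All.++⁺ (All.map (inj₁ ∘ proj₁) (All.filter⁺ _ old)) (All.map (inj₁ ∘ proj₁) arrivals)
  lateOld : All (λ a → k < slot a × rel (jobOf a) ≤ suc k) (lateJobs k B)
  lateOld = All.zipWith (λ (late , (_ , r≡1)) → late , subst (_≤ suc k) (sym r≡1) (s≤s z≤n))
    (All.all-filter _ B , All.filter⁺ _ old)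

-- In T₂ the jobs of S₁ (from v₁) compete with the stream S₄ (from v₁).
firstCost : ∀ k c → ValidSchedule (T₂ k) c →
  lateCount k (firstBlock (S₁ k) (S₂ k) (S₄ k) c) * (k * k) ≤ flow (T₂ k) c
firstCost k c valid = ≤-trans
  (streamCost v₁ v₄ k (k * k) U _ (U ++ V ++ Z) (++⁺ (filter-⊆ _ U) (++⁺ˡ V ⊆-refl)) released conflictFree
    (All.map (λ e → cong src e , cong rel e) (copies k _ _)))
  (≤-reflexive (sym (flow-blocks (S₁ k) (S₂ k) (S₄ k) c)))
  where
  U = firstBlock (S₁ k) (S₂ k) (S₄ k) c
  V = middleBlock (S₁ k) (S₂ k) (S₄ k) c
  Z = lastBlock (S₁ k) (S₂ k) (S₄ k) c
  released = proj₁ (valid-blocks (S₁ k) (S₂ k) (S₄ k) c valid)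
  conflictFree = proj₂ (valid-blocks (S₁ k) (S₂ k) (S₄ k) c valid)

-- In T₁ the jobs of S₂ (from v₃) compete with the stream S₃ (from v₃).
middleCost : ∀ k c → ValidSchedule (T₁ k) c →
  lateCount k (middleBlock (S₁ k) (S₂ k) (S₃ k) c) * (k * k) ≤ flow (T₁ k) c
middleCost k c valid = ≤-trans
  (streamCost v₃ v₄ k (k * k) V _ (U ++ V ++ Z) (++⁺ˡ U (++⁺ (filter-⊆ _ V) ⊆-refl)) released conflictFree
    (All.map (λ e → cong src e , cong rel e) (copies k _ _)))
  (≤-reflexive (sym (flow-blocks (S₁ k) (S₂ k) (S₃ k) c)))
  where
  U = firstBlock (S₁ k) (S₂ k) (S₃ k) c
  V = middleBlock (S₁ k) (S₂ k) (S₃ k) c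
  Z = lastBlock (S₁ k) (S₂ k) (S₃ k) c
  released = proj₁ (valid-blocks (S₁ k) (S₂ k) (S₃ k) c valid)
  conflictFree = proj₂ (valid-blocks (S₁ k) (S₂ k) (S₃ k) c valid)

-- The number of late S₂-jobs is the same in both instances, since the
-- algorithm cannot tell T₁ from T₂ before slot k + 1.
flow-lower-bound : ∀ k A c₁ c₂ → ValidSchedule (T₁ k) c₁ → Runs A (T₁ k) c₁ →
  ValidSchedule (T₂ k) c₂ → Runs A (T₂ k) c₂ → k * (k * k) ≤ flow (T₁ k) c₁ + flow (T₂ k) c₂
flow-lower-bound k A c₁ c₂ valid₁ run₁ valid₂ run₂ = begin
  k * N                                     ≤⟨ *-monoˡ-≤ N atLeastK ⟩
  (late₂ + late₁) * N                       ≡⟨ *-distribʳ-+ N late₂ late₁ ⟩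
  late₂ * N + late₁ * N                     ≤⟨ +-mono-≤ (firstCost k c₂ valid₂) (middleCost k c₁ valid₁) ⟩
  flow (T₂ k) c₂ + flow (T₁ k) c₁           ≡⟨ +-comm (flow (T₂ k) c₂) _ ⟩
  flow (T₁ k) c₁ + flow (T₂ k) c₂           ∎
  where
  open ≤-Reasoning
  N = k * k
  late₁ = lateCount k (middleBlock (S₁ k) (S₂ k) (S₃ k) c₁)
  late₂ = lateCount k (firstBlock (S₁ k) (S₂ k) (S₄ k) c₂)
  sameMiddle : late₁ ≡ lateCount k (middleBlock (S₁ k) (S₂ k) (S₄ k) c₂)
  sameMiddle = lateCount-agree k (S₂ k) _ _ λ i →
    online-agree k A (T₁ k) (T₂ k) c₁ c₂ run₁ run₂ (revealed-agree k) _ _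
      (trans (toℕ-middleIndex (S₁ k) (S₂ k) (S₃ k) c₁ i) (sym (toℕ-middleIndex (S₁ k) (S₂ k) (S₄ k) c₂ i)))
  atLeastK : k ≤ late₂ + late₁
  atLeastK = subst (λ m → k ≤ late₂ + m) (sym sameMiddle) (firstPhase k (S₄ k) c₂ valid₂)

njobs-cubed : ∀ k → njobs k ^ 3 ≤ (6 * (k * (k * k))) ^ 2
njobs-cubed k = begin
  njobs k ^ 3                 ≤⟨ ^-monoˡ-≤ 3 (+-monoʳ-≤ (k * k) (*-monoʳ-≤ 2 (k≤k*k k))) ⟩
  (k * k + 2 * (k * k)) ^ 3   ≡⟨ cube k ⟩
  27 * k⁶                     ≤⟨ *-monoˡ-≤ k⁶ (m≤m+n 27 9) ⟩
  36 * k⁶                     ≡⟨ square k ⟩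
  (6 * (k * (k * k))) ^ 2     ∎
  where
  open ≤-Reasoning
  k⁶ = (k * (k * k)) * (k * (k * k))
  k≤k*k : ∀ k → k ≤ k * k
  k≤k*k zero    = z≤n
  k≤k*k (suc k) = m≤m*n (suc k) (suc k)
  -- x ^ 3 and x ^ 2 unfold to x * (x * (x * 1)) and x * (x * 1).
  cube : ∀ k → let x = k * k + 2 * (k * k) in x * (x * (x * 1)) ≡ 27 * ((k * (k * k)) * (k * (k * k)))
  cube = solve-∀
  square : ∀ k → let y = 6 * (k * (k * k)) in 36 * ((k * (k * k)) * (k * (k * k))) ≡ y * (y * 1)
  square = solve-∀

-- The theorem, with d = 6 and k₀ = 0.
lemma15 : ∃[ d ] ∃[ k₀ ] ((k : ℕ) → k₀ ≤ k → 2 ∣ k * k →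
            (A : OnlineAlg) (c₁ : Fin (length (T₁ k)) → ℕ) (c₂ : Fin (length (T₂ k)) → ℕ) →
            ValidSchedule (T₁ k) c₁ → Runs A (T₁ k) c₁ →
            ValidSchedule (T₂ k) c₂ → Runs A (T₂ k) c₂ →
            njobs k ^ 3 ≤ (d * (flow (T₁ k) c₁ + flow (T₂ k) c₂)) ^ 2)
lemma15 = 6 , 0 , λ k _ _ A c₁ c₂ valid₁ run₁ valid₂ run₂ →
  ≤-trans (njobs-cubed k) (^-monoˡ-≤ 2 (*-monoʳ-≤ 6 (flow-lower-bound k A c₁ c₂ valid₁ run₁ valid₂ run₂)))
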